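{- The only finite geometric lattice that has a two-element level is $M_2$.
   Context: A finite geometric lattice is graded; its $k$-th level is the set of elements of rank $k$. A two-element level means a level consisting of exactly two elements. $M_2$ denotes the four-element lattice consisting of a bottom, a top and two incomparable elements (atoms) between them. -}

module Defs where

open import Level using (Level; _⊔_)
open import Data.Nat using (ℕ; zero; suc)
open import Data.List using (List; foldr)
open import Data.List.Relation.Unary.Any using (Any)
open import Data.List.Relation.Unary.All using (All)
open import Data.Product using (Σ; ∃; ∃-syntax; _×_)
open import Data.Sum using (_⊎_)
open import Relation.Nullary using (¬_)
open import Relation.Binary.PropositionalEquality using (_≡_)
open import Relation.Binary.Lattice.Bundles using (BoundedLattice)

data M₂ : Set where
  bot a b top : M₂

data _≤M₂_ : M₂ → M₂ → Set where
  bot≤ : ∀ {x} → bot ≤M₂ x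
  ≤top : ∀ {x} → x ≤M₂ top
  a≤a  : a ≤M₂ a
  b≤b  : b ≤M₂ b

module _ {c ℓ₁ ℓ₂ : Level} (L : BoundedLattice c ℓ₁ ℓ₂) where
  open BoundedLattice L

  _<_ : Carrier → Carrier → Set (ℓ₁ ⊔ ℓ₂)
  x < y = x ≤ y × ¬ (x ≈ y)

  _⋖_ : Carrier → Carrier → Set (c ⊔ ℓ₁ ⊔ ℓ₂)
  x ⋖ y = x < y × (∀ z → x ≤ z → z ≤ y → (z ≈ x) ⊎ (z ≈ y))

  IsAtom : Carrier → Set (c ⊔ ℓ₁ ⊔ ℓ₂)
  IsAtom x = ⊥ ⋖ x

  IsFinite : Set (c ⊔ ℓ₁)
  IsFinite = ∃[ xs ] (∀ x → Any (x ≈_) xs)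

  IsAtomistic : Set (c ⊔ ℓ₁ ⊔ ℓ₂)
  IsAtomistic = ∀ x → ∃[ as ] (All IsAtom as × foldr _∨_ ⊥ as ≈ x)

  IsSemimodular : Set (c ⊔ ℓ₁ ⊔ ℓ₂)
  IsSemimodular = ∀ x y → (x ∧ y) ⋖ x → y ⋖ (x ∨ y)

  IsFiniteGeometric : Set (c ⊔ ℓ₁ ⊔ ℓ₂)
  IsFiniteGeometric = IsFinite × IsAtomistic × IsSemimodular

  -- HasRank k x : there is a maximal chain ⊥ = x₀ ⋖ x₁ ⋖ … ⋖ xₖ = x,
  -- i.e. x has rank k (in a graded lattice).
  data HasRank : ℕ → Carrier → Set (c ⊔ ℓ₁ ⊔ ℓ₂) where
    rank0   : ∀ {x} → x ≈ ⊥ → HasRank zero x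
    rankSuc : ∀ {k x y} → HasRank k x → x ⋖ y → HasRank (suc k) y

  TwoElementLevel : ℕ → Set (c ⊔ ℓ₁ ⊔ ℓ₂)
  TwoElementLevel k =
    ∃[ x ] ∃[ y ] (HasRank k x × HasRank k y × ¬ (x ≈ y)
                  × (∀ z → HasRank k z → (z ≈ x) ⊎ (z ≈ y)))

  record IsoM₂ : Set (c ⊔ ℓ₁ ⊔ ℓ₂) where
    field
      to      : Carrier → M₂
      from    : M₂ → Carrier
      from∘to : ∀ x → from (to x) ≈ x
      to∘from : ∀ m → to (from m) ≡ m
      to-mono : ∀ {x y} → x ≤ y → to x ≤M₂ to y
      to-refl : ∀ {x y} → to x ≤M₂ to y → x ≤ y

-- Rank 1: an atomistic lattice with exactly two atoms x, y consists of the
-- joins of x and y, so it is {⊥, x, y, x ∨ y} ≅ M₂.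
-- Rank ≥ 2: pick x in the level and an atom s ≰ x (one exists for one of the
-- two elements, as they differ).  Lower x along its chain to u ⋖ x and w ⋖ u,
-- and pick an atom p ≤ x, p ≰ u.  By semimodularity s ∨ u and s ∨ (p ∨ w) lie
-- in the level above s, hence both equal the other element; then p ∨ u lies
-- below the two distinct covers x and s ∨ u of u, forcing p ≤ u.
module Submission where

open import Defs renaming (_⋖_ to Covers)
open import Level using (Level)
open import Data.Nat using (ℕ; zero; suc; _+_)
open import Relation.Binary.Lattice.Bundles using (BoundedLattice)
open import Data.List using (List; []; _∷_; foldr)
open import Data.List.Membership.Propositional using (_∈_)
open import Data.List.Relation.Unary.Any using (here; there)
open import Data.List.Relation.Unary.All as All using (All; []; _∷_)
open import Data.Product using (∃-syntax; _×_; _,_; proj₁; proj₂)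
open import Data.Sum using (_⊎_; inj₁; inj₂; swap; map₁)
open import Data.Empty using (⊥-elim)
open import Function using (_∘_)
open import Relation.Nullary using (¬_; contradiction)
open import Relation.Binary.PropositionalEquality as ≡ using (_≡_)
import Relation.Binary.Lattice.Properties.JoinSemilattice as JoinSemilatticeProperties
import Relation.Binary.Lattice.Properties.BoundedJoinSemilattice as BoundedJoinSemilatticeProperties

≤M₂-antisym : ∀ {m n} → m ≤M₂ n → n ≤M₂ m → m ≡ n
≤M₂-antisym bot≤ bot≤ = ≡.refl
≤M₂-antisym ≤top ≤top = ≡.refl
≤M₂-antisym a≤a  _    = ≡.refl
≤M₂-antisym b≤b  _    = ≡.refl

module _ {c ℓ₁ ℓ₂ : Level} (L : BoundedLattice c ℓ₁ ℓ₂) where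
  open BoundedLattice L
  open JoinSemilatticeProperties joinSemilattice using (∨-comm; ∨-cong; ∨-idempotent; x≤y⇒x∨y≈y)
  open BoundedJoinSemilatticeProperties boundedJoinSemilattice using (identityʳ)

  infix 4 _⋖_
  _⋖_ : Carrier → Carrier → Set _
  _⋖_ = Covers L

  ⋁ : List Carrier → Carrier
  ⋁ = foldr _∨_ ⊥

  ⋖⇒≤ : ∀ {x y} → x ⋖ y → x ≤ y
  ⋖⇒≤ x⋖y = proj₁ (proj₁ x⋖y)

  ⋖⇒≉ : ∀ {x y} → x ⋖ y → ¬ x ≈ y
  ⋖⇒≉ x⋖y = proj₂ (proj₁ x⋖y)

  ⋖-between : ∀ {x y z} → x ⋖ y → x ≤ z → z ≤ y → z ≈ x ⊎ z ≈ y
  ⋖-between x⋖y = proj₂ x⋖y _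

  ⋖-respˡ-≈ : ∀ {x x′ y} → x ≈ x′ → x ⋖ y → x′ ⋖ y
  ⋖-respˡ-≈ x≈x′ x⋖y =
    (≤-respˡ-≈ x≈x′ (⋖⇒≤ x⋖y) , ⋖⇒≉ x⋖y ∘ Eq.trans x≈x′) ,
    λ z x′≤z z≤y → map₁ (λ z≈x → Eq.trans z≈x x≈x′)
                     (⋖-between x⋖y (≤-respˡ-≈ (Eq.sym x≈x′) x′≤z) z≤y)

  distinct-covers-meet : ∀ {u a b z} → u ⋖ a → u ⋖ b → ¬ a ≈ b →
                         u ≤ z → z ≤ a → z ≤ b → z ≈ u
  distinct-covers-meet u⋖a u⋖b a≉b u≤z z≤a z≤b with ⋖-between u⋖a u≤z z≤a
  ... | inj₁ z≈u = z≈u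
  ... | inj₂ z≈a with ⋖-between u⋖b (⋖⇒≤ u⋖a) (≤-respˡ-≈ z≈a z≤b)
  ...   | inj₁ a≈u = contradiction (Eq.sym a≈u) (⋖⇒≉ u⋖a)
  ...   | inj₂ a≈b = contradiction a≈b a≉b

  rank1⇒atom : ∀ {p} → HasRank L 1 p → IsAtom L p
  rank1⇒atom (rankSuc (rank0 q≈⊥) q⋖p) = ⋖-respˡ-≈ q≈⊥ q⋖p

  atom⇒rank1 : ∀ {p} → IsAtom L p → HasRank L 1 p
  atom⇒rank1 = rankSuc (rank0 Eq.refl)

  atom≰⊥ : ∀ {p} → IsAtom L p → ¬ p ≤ ⊥
  atom≰⊥ p-atom p≤⊥ = ⋖⇒≉ p-atom (antisym (minimum _) p≤⊥)

  atom≤atom⇒≈ : ∀ {p q} → IsAtom L p → IsAtom L q → p ≤ q → p ≈ q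
  atom≤atom⇒≈ p-atom q-atom p≤q with ⋖-between q-atom (minimum _) p≤q
  ... | inj₁ p≈⊥ = contradiction (Eq.sym p≈⊥) (⋖⇒≉ p-atom)
  ... | inj₂ p≈q = p≈q

  atom∧≈⊥ : ∀ {s u} → IsAtom L s → ¬ s ≤ u → s ∧ u ≈ ⊥
  atom∧≈⊥ {s} {u} s-atom s≰u with ⋖-between s-atom (minimum _) (x∧y≤x s u)
  ... | inj₁ s∧u≈⊥ = s∧u≈⊥
  ... | inj₂ s∧u≈s = contradiction (≤-respˡ-≈ s∧u≈s (x∧y≤y s u)) s≰u

  ∈⇒≤⋁ : ∀ {p as} → p ∈ as → p ≤ ⋁ as
  ∈⇒≤⋁ (here ≡.refl)   = x≤x∨y _ _
  ∈⇒≤⋁ (there p∈as) = trans (∈⇒≤⋁ p∈as) (y≤x∨y _ _)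

  ¬¬⋁-least : ∀ {u as} → All (λ p → ¬ ¬ p ≤ u) as → ¬ ¬ ⋁ as ≤ u
  ¬¬⋁-least []                  ⋁≰u = ⋁≰u (minimum _)
  ¬¬⋁-least (¬¬p≤u ∷ ¬¬as≤u) ⋁≰u =
    ¬¬p≤u λ p≤u → ¬¬⋁-least ¬¬as≤u λ ⋁as≤u → ⋁≰u (∨-least p≤u ⋁as≤u)

  IsoM₂-from-embedding : (f : M₂ → Carrier) →
                         (∀ {m n} → m ≤M₂ n → f m ≤ f n) →
                         (∀ {m n} → f m ≤ f n → m ≤M₂ n) →
                         (∀ z → ∃[ m ] f m ≈ z) → IsoM₂ L
  IsoM₂-from-embedding f f-mono f-reflects onto = record
    { to      = to
    ; from    = f
    ; from∘to = f∘to
    ; to∘from = λ m → ≤M₂-antisym (f-reflects (reflexive (f∘to (f m))))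
                                  (f-reflects (reflexive (Eq.sym (f∘to (f m)))))
    ; to-mono = λ x≤y → f-reflects (≤-respʳ-≈ (Eq.sym (f∘to _)) (≤-respˡ-≈ (Eq.sym (f∘to _)) x≤y))
    ; to-refl = λ to≤to → ≤-respʳ-≈ (f∘to _) (≤-respˡ-≈ (f∘to _) (f-mono to≤to))
    }
    where
    to : Carrier → M₂
    to z = proj₁ (onto z)
    f∘to : ∀ z → f (to z) ≈ z
    f∘to z = proj₂ (onto z)

  atom-⋖-∨ : IsSemimodular L → ∀ {s u} → IsAtom L s → ¬ s ≤ u → u ⋖ s ∨ u
  atom-⋖-∨ semimodular {s} {u} s-atom s≰u =
    semimodular s u (⋖-respˡ-≈ (Eq.sym (atom∧≈⊥ s-atom s≰u)) s-atom)

  module _ (atomistic : IsAtomistic L) where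

    -- ≤ need not be decidable, so an atom witnessing x ≰ u is only found
    -- under double negation.
    ¬¬≤-by-atoms : ∀ {x u} → (∀ {p} → IsAtom L p → p ≤ x → ¬ ¬ p ≤ u) → ¬ ¬ x ≤ u
    ¬¬≤-by-atoms {x} atoms≤u x≰u with atomistic x
    ... | as , as-atoms , ⋁as≈x =
      ¬¬⋁-least (All.tabulate λ p∈as → atoms≤u (All.lookup as-atoms p∈as)
                                               (≤-respʳ-≈ ⋁as≈x (∈⇒≤⋁ p∈as)))
                (x≰u ∘ ≤-respˡ-≈ ⋁as≈x)

    module TwoAtoms {x y : Carrier} (x-atom : IsAtom L x) (y-atom : IsAtom L y)
                    (x≉y : ¬ x ≈ y) (atoms : ∀ {p} → IsAtom L p → p ≈ x ⊎ p ≈ y) where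

      incl : M₂ → Carrier
      incl bot = ⊥
      incl a   = x
      incl b   = y
      incl top = x ∨ y

      incl-mono : ∀ {m n} → m ≤M₂ n → incl m ≤ incl n
      incl-mono {n = n} bot≤ = minimum (incl n)
      incl-mono {bot} ≤top   = minimum _
      incl-mono {a}   ≤top   = x≤x∨y x y
      incl-mono {b}   ≤top   = y≤x∨y x y
      incl-mono {top} ≤top   = refl
      incl-mono a≤a          = refl
      incl-mono b≤b          = refl

      x≰y : ¬ x ≤ y
      x≰y = x≉y ∘ atom≤atom⇒≈ x-atom y-atom

      y≰x : ¬ y ≤ x
      y≰x = x≉y ∘ Eq.sym ∘ atom≤atom⇒≈ y-atom x-atom

      incl-reflects : ∀ {m n} → incl m ≤ incl n → m ≤M₂ n
      incl-reflects {bot}         _   = bot≤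
      incl-reflects {_}   {top}   _   = ≤top
      incl-reflects {a}   {a}     _   = a≤a
      incl-reflects {b}   {b}     _   = b≤b
      incl-reflects {a}   {bot}   x≤⊥ = contradiction x≤⊥ (atom≰⊥ x-atom)
      incl-reflects {b}   {bot}   y≤⊥ = contradiction y≤⊥ (atom≰⊥ y-atom)
      incl-reflects {top} {bot}   ≤⊥  = contradiction (trans (x≤x∨y x y) ≤⊥) (atom≰⊥ x-atom)
      incl-reflects {a}   {b}     x≤y = contradiction x≤y x≰y
      incl-reflects {b}   {a}     y≤x = contradiction y≤x y≰x
      incl-reflects {top} {a}     ≤x  = contradiction (trans (y≤x∨y x y) ≤x) y≰x
      incl-reflects {top} {b}     ≤y  = contradiction (trans (x≤x∨y x y) ≤y) x≰y

      x∨-closed : ∀ m → ∃[ k ] incl k ≈ x ∨ incl m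
      x∨-closed bot = a   , Eq.sym (identityʳ x)
      x∨-closed a   = a   , Eq.sym (∨-idempotent x)
      x∨-closed b   = top , Eq.refl
      x∨-closed top = top , Eq.sym (x≤y⇒x∨y≈y (x≤x∨y x y))

      y∨-closed : ∀ m → ∃[ k ] incl k ≈ y ∨ incl m
      y∨-closed bot = b   , Eq.sym (identityʳ y)
      y∨-closed a   = top , ∨-comm x y
      y∨-closed b   = b   , Eq.sym (∨-idempotent y)
      y∨-closed top = top , Eq.sym (x≤y⇒x∨y≈y (y≤x∨y x y))

      incl-onto-⋁ : ∀ {as} → All (IsAtom L) as → ∃[ m ] incl m ≈ ⋁ as
      incl-onto-⋁ []                  = bot , Eq.refl
      incl-onto-⋁ (p-atom ∷ as-atoms) with incl-onto-⋁ as-atoms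
      ... | m , incl-m≈⋁as with atoms p-atom
      ...   | inj₁ p≈x = let k , e = x∨-closed m in
                          k , Eq.trans e (∨-cong (Eq.sym p≈x) incl-m≈⋁as)
      ...   | inj₂ p≈y = let k , e = y∨-closed m in
                          k , Eq.trans e (∨-cong (Eq.sym p≈y) incl-m≈⋁as)

      incl-onto : ∀ z → ∃[ m ] incl m ≈ z
      incl-onto z with atomistic z
      ... | as , as-atoms , ⋁as≈z with incl-onto-⋁ as-atoms
      ...   | m , incl-m≈⋁as = m , Eq.trans incl-m≈⋁as ⋁as≈z

      iso : IsoM₂ L
      iso = IsoM₂-from-embedding incl incl-mono incl-reflects incl-onto

    module _ (semimodular : IsSemimodular L) where

      ¬unique-rank-above-outside-atom :
        ∀ {j x s} → HasRank L (2 + j) x → IsAtom L s → ¬ s ≤ x →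
        ¬ (∀ z z′ → HasRank L (2 + j) z → HasRank L (2 + j) z′ → s ≤ z → s ≤ z′ → z ≈ z′)
      ¬unique-rank-above-outside-atom {x = x} {s}
        (rankSuc (rankSuc {x = w} {y = u} w-rank w⋖u) u⋖x) s-atom s≰x unique =
        ¬¬≤-by-atoms new-atom-impossible (⋖⇒≉ u⋖x ∘ antisym u≤x)
        where
        u≤x = ⋖⇒≤ u⋖x
        w≤u = ⋖⇒≤ w⋖u

        s-outside : ∀ {t} → t ≤ x → ¬ s ≤ t
        s-outside t≤x s≤t = s≰x (trans s≤t t≤x)

        u⋖s∨u : u ⋖ s ∨ u
        u⋖s∨u = atom-⋖-∨ semimodular s-atom (s-outside u≤x)

        x≉s∨u : ¬ x ≈ s ∨ u
        x≉s∨u x≈s∨u = s≰x (≤-respʳ-≈ (Eq.sym x≈s∨u) (x≤x∨y s u))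

        new-atom-impossible : ∀ {p} → IsAtom L p → p ≤ x → ¬ ¬ p ≤ u
        new-atom-impossible {p} p-atom p≤x p≰u =
          p≰u (≤-respʳ-≈ p∨u≈u (x≤x∨y p u))
          where
          v = p ∨ w
          v≤x : v ≤ x
          v≤x = ∨-least p≤x (trans w≤u u≤x)
          w⋖v : w ⋖ v
          w⋖v = atom-⋖-∨ semimodular p-atom (λ p≤w → p≰u (trans p≤w w≤u))
          s∨u≈s∨v : s ∨ u ≈ s ∨ v
          s∨u≈s∨v = unique (s ∨ u) (s ∨ v)
            (rankSuc (rankSuc w-rank w⋖u) u⋖s∨u)
            (rankSuc (rankSuc w-rank w⋖v) (atom-⋖-∨ semimodular s-atom (s-outside v≤x)))
            (x≤x∨y s u) (x≤x∨y s v)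
          p≤s∨u : p ≤ s ∨ u
          p≤s∨u = trans (x≤x∨y p w) (≤-respʳ-≈ (Eq.sym s∨u≈s∨v) (y≤x∨y s v))
          p∨u≈u : p ∨ u ≈ u
          p∨u≈u = distinct-covers-meet u⋖x u⋖s∨u x≉s∨u
            (y≤x∨y p u) (∨-least p≤x u≤x) (∨-least p≤s∨u (y≤x∨y s u))

      atom≤-in-level⊆pair : ∀ {j x y} → HasRank L (2 + j) x →
        (∀ z → HasRank L (2 + j) z → z ≈ x ⊎ z ≈ y) →
        ∀ {s} → IsAtom L s → ¬ ¬ s ≤ x
      atom≤-in-level⊆pair {x = x} {y} x-rank level {s} s-atom s≰x =
        ¬unique-rank-above-outside-atom x-rank s-atom s≰x λ z z′ z-rank z′-rank s≤z s≤z′ →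
          Eq.trans (≈y (level z z-rank) s≤z) (Eq.sym (≈y (level z′ z′-rank) s≤z′))
        where
        ≈y : ∀ {z} → z ≈ x ⊎ z ≈ y → s ≤ z → z ≈ y
        ≈y (inj₁ z≈x) s≤z = contradiction (≤-respʳ-≈ z≈x s≤z) s≰x
        ≈y (inj₂ z≈y) _   = z≈y

      ¬two-element-level-≥2 : ∀ {j} → ¬ TwoElementLevel L (2 + j)
      ¬two-element-level-≥2 (x , y , x-rank , y-rank , x≉y , level) =
        ¬¬≤-by-atoms (λ p-atom _ → atom≤-in-level⊆pair y-rank (λ z → swap ∘ level z) p-atom) λ x≤y →
        ¬¬≤-by-atoms (λ p-atom _ → atom≤-in-level⊆pair x-rank level p-atom) λ y≤x →
        x≉y (antisym x≤y y≤x)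

  ¬two-element-level-0 : ¬ TwoElementLevel L 0
  ¬two-element-level-0 (x , y , rank0 x≈⊥ , rank0 y≈⊥ , x≉y , _) = x≉y (Eq.trans x≈⊥ (Eq.sym y≈⊥))

theorem2 : {c ℓ₁ ℓ₂ : Level} (L : BoundedLattice c ℓ₁ ℓ₂) →
    IsFiniteGeometric L → (k : ℕ) → TwoElementLevel L k → IsoM₂ L
theorem2 L _ zero level = ⊥-elim (¬two-element-level-0 L level)
theorem2 L (_ , atomistic , _) (suc zero) (x , y , x-rank , y-rank , x≉y , level) =
  TwoAtoms.iso L atomistic (rank1⇒atom L x-rank) (rank1⇒atom L y-rank) x≉y
    (λ p-atom → level _ (atom⇒rank1 L p-atom))
theorem2 L (_ , atomistic , semimodular) (suc (suc j)) level =
  ⊥-elim (¬two-element-level-≥2 L atomistic semimodular level)
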